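{- Let $q$ be a power of an odd prime, let $\lambda\in\mathbb{F}_q$ be a non-square, and let $a\in\mathbb{F}_q$. The graph $\mathcal{G}(\lambda,X+a)$ has a (weakly) connected component with exactly three vertices if and only if either $\lambda=2,\ a=1$, or $\lambda=1/2,\ a=2$. In particular, if $2$ is a non-square in $\mathbb{F}_q$, then the vertices $0,1,-1$ form a connected component of $\mathcal{G}(2,X+1)$, and the vertices $0,2,-2$ form a connected component of $\mathcal{G}(1/2,X+2)$.
   Context: For a polynomial $f\in\mathbb{F}_q[X]$ and a non-square $\lambda\in\mathbb{F}_q$, $\mathcal{G}(\lambda,f)$ is the directed graph with vertex set $\mathbb{F}_q$ and an edge from $x$ to $y$ iff $(y^2-f(x))(\lambda y^2-f(x))=0$ (loops allowed). -}

module Defs where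

open import Level using (0ℓ)
open import Algebra.Bundles using (CommutativeRing)
open import Data.Product using (Σ; ∃; _×_; _,_)
open import Data.Sum using (_⊎_)
open import Data.List using (List)
open import Data.List.Relation.Unary.Any using (Any)
open import Relation.Nullary using (¬_)
open import Relation.Binary.Definitions using (Decidable)
open import Relation.Binary.Construct.Closure.Equivalence using (EqClosure)

record FiniteField : Set₁ where
  field
    commRing : CommutativeRing 0ℓ 0ℓ
  open CommutativeRing commRing public
  field
    _≟_      : Decidable _≈_
    1≉0      : ¬ (1# ≈ 0#)
    inverse  : ∀ x → ¬ (x ≈ 0#) → ∃ λ y → x * y ≈ 1#
    elements : List Carrier
    complete : ∀ x → Any (x ≈_) elements

module _ (F : FiniteField) where
  open FiniteField F

  two : Carrier
  two = 1# + 1#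

  -- odd characteristic, i.e. q is a power of an odd prime
  OddChar : Set
  OddChar = ¬ (two ≈ 0#)

  IsSquare : Carrier → Set
  IsSquare c = ∃ λ z → z * z ≈ c

  NonSquare : Carrier → Set
  NonSquare c = ¬ IsSquare c

  Edge : Carrier → (Carrier → Carrier) → Carrier → Carrier → Set
  Edge λ' f x y = ((y * y - f x) * (λ' * (y * y) - f x)) ≈ 0#

  Adj : Carrier → (Carrier → Carrier) → Carrier → Carrier → Set
  Adj λ' f x y = Edge λ' f x y ⊎ x ≈ y

  Connected : Carrier → (Carrier → Carrier) → Carrier → Carrier → Set
  Connected λ' f = EqClosure (Adj λ' f)

  ComponentIs : Carrier → (Carrier → Carrier) → Carrier →
                Carrier → Carrier → Carrier → Set
  ComponentIs λ' f v a b c =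
    ∀ y → (Connected λ' f v y → (y ≈ a ⊎ y ≈ b ⊎ y ≈ c))
        × ((y ≈ a ⊎ y ≈ b ⊎ y ≈ c) → Connected λ' f v y)

  HasComponentOfSize3 : Carrier → (Carrier → Carrier) → Set
  HasComponentOfSize3 λ' f =
    ∃ λ v → ∃ λ a → ∃ λ b → ∃ λ c →
      ¬ (a ≈ b) × ¬ (a ≈ c) × ¬ (b ≈ c) × ComponentIs λ' f v a b c

-- An edge x → y of 𝒢(λ, X + a) says that x + a is y² or λy². As λ is a non-square, the
-- out-neighbours of x are ±s whenever x + a ∈ {s², λs²} with s ≠ 0, and the in-neighbours
-- of y are y² − a and λy² − a. A component C with exactly three vertices is closed under
-- y ↦ −y (both are out-neighbours of y² − a), and an involution of a three-element set has a
-- fixed point, so 0 ∈ C; hence its in-neighbour −a ∈ C, and a ∈ C. Here a ≠ 0, since for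
-- a = 0 the vertex 0 is isolated, so C = {0, a, −a}. The distinct in-neighbours a² − a and
-- λa² − a of a lie in C and differ from −a, so they are 0 and a: {a², λa²} = {a, 2a}, which
-- forces (λ, a) = (2, 1) or (1/2, 2). Conversely this condition makes {0, a, −a} closed under
-- taking in- and out-neighbours.
module Submission where

open import Defs
open import Level using (Level; 0ℓ)
open import Algebra.Bundles using (CommutativeRing)
open import Algebra.Solver.Ring.AlmostCommutativeRing
  using (fromCommutativeRing; _-Raw-AlmostCommutative⟶_)
import Algebra.Solver.Ring as RingSolver
open import Data.Fin as Fin using (Fin)
open import Data.Fin.Properties using (injective⇒≤)
open import Data.Integer as ℤ using (ℤ; +_; -[1+_]; _⊖_; _◃_; sign; ∣_∣)
import Data.Integer.Properties as ℤ
open import Data.List using (List; []; _∷_; length; lookup)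
import Data.List.Membership.Propositional.Properties as ∈ₚ
import Data.List.Relation.Unary.All as All
open import Data.List.Relation.Unary.All using ([]; _∷_)
open import Data.List.Relation.Unary.All.Properties using (¬Any⇒All¬)
open import Data.List.Relation.Unary.AllPairs using ([]; _∷_)
open import Data.List.Relation.Unary.Any using (here; there; index)
open import Data.Maybe using (Maybe; just; nothing)
open import Data.Nat as ℕ using (zero; suc; _≤_)
import Data.Nat.Properties as ℕ
open import Data.Product using (_×_; _,_; proj₁; proj₂)
open import Data.Sign as Sign using (Sign)
open import Data.Sum using (_⊎_; inj₁; inj₂; [_,_]; map₂; swap; reduce) renaming (map to ⊎-map)
open import Function using (_∘_)
open import Function.Bundles using (_⇔_; mk⇔; Equivalence)
open import Function.Properties.Equivalence using (⇔-isEquivalence)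
open import Relation.Binary.Bundles using (DecSetoid)
import Relation.Binary.Construct.Closure.Equivalence as EqClosure
import Relation.Binary.PropositionalEquality as ≡
open import Relation.Nullary using (¬_; yes; no; contradiction)

open Equivalence using (to; from)

-- Algebra.Solver.Ring.Simple needs a computing _≟_ on coefficients, which an abstract
-- field lacks; coefficients from ℤ work in any commutative ring.
module IntegerCoefficientSolver {c ℓ : Level} (R : CommutativeRing c ℓ) where
  open CommutativeRing R
  open import Algebra.Properties.Ring ring using (-0#≈0#; -‿involutive; -1*x≈-x; -‿+-comm)
  open import Algebra.Properties.CommutativeSemigroup +-commutativeSemigroup
    using () renaming (interchange to +-interchange)
  open import Algebra.Properties.CommutativeSemigroup *-commutativeSemigroup
    using () renaming (interchange to *-interchange)
  open import Algebra.Properties.Semiring.Mult.TCOptimised semiring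
    using (×-homo-+; ×1-homo-*) renaming (_×_ to _·_)
  open import Relation.Binary.Reasoning.Setoid setoid

  -- The type-checking-optimised _·_ makes ⟦ + 2 ⟧ℤ reduce to 1# + 1#, so solver numerals match two F.
  ⟦_⟧ℤ : ℤ → Carrier
  ⟦ + n ⟧ℤ      = n · 1#
  ⟦ -[1+ n ] ⟧ℤ = - (suc n · 1#)

  ⊖-homo : ∀ m n → ⟦ m ⊖ n ⟧ℤ ≈ m · 1# - n · 1#
  ⊖-homo zero    zero    = sym (trans (+-congˡ -0#≈0#) (+-identityʳ 0#))
  ⊖-homo zero    (suc n) = sym (+-identityˡ _)
  ⊖-homo (suc m) zero    = sym (trans (+-congˡ -0#≈0#) (+-identityʳ _))
  ⊖-homo (suc m) (suc n) = begin
    ⟦ suc m ⊖ suc n ⟧ℤ                 ≡⟨ ≡.cong ⟦_⟧ℤ (ℤ.[1+m]⊖[1+n]≡m⊖n m n) ⟩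
    ⟦ m ⊖ n ⟧ℤ                         ≈⟨ ⊖-homo m n ⟩
    m · 1# - n · 1#                    ≈⟨ +-identityˡ _ ⟨
    0# + (m · 1# - n · 1#)             ≈⟨ +-congʳ (-‿inverseʳ 1#) ⟨
    (1# - 1#) + (m · 1# - n · 1#)      ≈⟨ +-interchange _ _ _ _ ⟩
    (1# + m · 1#) + (- 1# - n · 1#)    ≈⟨ +-congʳ (×-homo-+ 1# 1 m) ⟨
    suc m · 1# + (- 1# - n · 1#)       ≈⟨ +-congˡ (-‿+-comm 1# (n · 1#)) ⟩
    suc m · 1# - (1# + n · 1#)         ≈⟨ +-congˡ (-‿cong (×-homo-+ 1# 1 n)) ⟨
    suc m · 1# - suc n · 1#            ∎

  +-homo : ∀ i j → ⟦ i ℤ.+ j ⟧ℤ ≈ ⟦ i ⟧ℤ + ⟦ j ⟧ℤ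
  +-homo (+ m)    (+ n)    = ×-homo-+ 1# m n
  +-homo (+ m)    -[1+ n ] = ⊖-homo m (suc n)
  +-homo -[1+ m ] (+ n)    = trans (⊖-homo n (suc m)) (+-comm _ _)
  +-homo -[1+ m ] -[1+ n ] = begin
    - (suc (suc (m ℕ.+ n)) · 1#)    ≡⟨ ≡.cong (λ k → - (suc k · 1#)) (ℕ.+-suc m n) ⟨
    - ((suc m ℕ.+ suc n) · 1#)      ≈⟨ -‿cong (×-homo-+ 1# (suc m) (suc n)) ⟩
    - (suc m · 1# + suc n · 1#)     ≈⟨ -‿+-comm _ _ ⟨
    - (suc m · 1#) - suc n · 1#     ∎

  ⟦_⟧ₛ : Sign → Carrier
  ⟦ Sign.+ ⟧ₛ = 1#
  ⟦ Sign.- ⟧ₛ = - 1#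

  *-homoₛ : ∀ s t → ⟦ s Sign.* t ⟧ₛ ≈ ⟦ s ⟧ₛ * ⟦ t ⟧ₛ
  *-homoₛ Sign.+ t      = sym (*-identityˡ _)
  *-homoₛ Sign.- Sign.+ = sym (*-identityʳ _)
  *-homoₛ Sign.- Sign.- = sym (trans (-1*x≈-x _) (-‿involutive _))

  ◃-homo : ∀ s n → ⟦ s ◃ n ⟧ℤ ≈ ⟦ s ⟧ₛ * n · 1#
  ◃-homo s      zero    = sym (zeroʳ _)
  ◃-homo Sign.+ (suc n) = sym (*-identityˡ _)
  ◃-homo Sign.- (suc n) = sym (-1*x≈-x _)

  sign-abs : ∀ i → ⟦ i ⟧ℤ ≈ ⟦ sign i ⟧ₛ * ∣ i ∣ · 1#
  sign-abs i = begin
    ⟦ i ⟧ℤ                          ≡⟨ ≡.cong ⟦_⟧ℤ (ℤ.◃-inverse i) ⟨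
    ⟦ sign i ◃ ∣ i ∣ ⟧ℤ              ≈⟨ ◃-homo (sign i) ∣ i ∣ ⟩
    ⟦ sign i ⟧ₛ * ∣ i ∣ · 1#         ∎

  *-homo : ∀ i j → ⟦ i ℤ.* j ⟧ℤ ≈ ⟦ i ⟧ℤ * ⟦ j ⟧ℤ
  *-homo i j = begin
    ⟦ (sign i Sign.* sign j) ◃ (∣ i ∣ ℕ.* ∣ j ∣) ⟧ℤ               ≈⟨ ◃-homo _ (∣ i ∣ ℕ.* ∣ j ∣) ⟩
    ⟦ sign i Sign.* sign j ⟧ₛ * (∣ i ∣ ℕ.* ∣ j ∣) · 1#             ≈⟨ *-cong (*-homoₛ (sign i) (sign j)) (×1-homo-* ∣ i ∣ ∣ j ∣) ⟩
    (⟦ sign i ⟧ₛ * ⟦ sign j ⟧ₛ) * (∣ i ∣ · 1# * ∣ j ∣ · 1#)        ≈⟨ *-interchange _ _ _ _ ⟩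
    (⟦ sign i ⟧ₛ * ∣ i ∣ · 1#) * (⟦ sign j ⟧ₛ * ∣ j ∣ · 1#)        ≈⟨ *-cong (sign-abs i) (sign-abs j) ⟨
    ⟦ i ⟧ℤ * ⟦ j ⟧ℤ                                               ∎

  -‿homo : ∀ i → ⟦ ℤ.- i ⟧ℤ ≈ - ⟦ i ⟧ℤ
  -‿homo (+ zero)  = sym -0#≈0#
  -‿homo (+ suc n) = refl
  -‿homo -[1+ n ]  = sym (-‿involutive _)

  ℤ-morphism : ℤ.+-*-rawRing -Raw-AlmostCommutative⟶ fromCommutativeRing R
  ℤ-morphism = record
    { ⟦_⟧    = ⟦_⟧ℤ
    ; +-homo = +-homo
    ; *-homo = *-homo
    ; -‿homo = -‿homo
    ; 0-homo = refl
    ; 1-homo = refl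
    }

  coefficient-≟ : ∀ i j → Maybe (⟦ i ⟧ℤ ≈ ⟦ j ⟧ℤ)
  coefficient-≟ i j with i ℤ.≟ j
  ... | yes ≡.refl = just refl
  ... | no _       = nothing

  open RingSolver ℤ.+-*-rawRing (fromCommutativeRing R) ℤ-morphism coefficient-≟ public

module UniquePigeonhole {c ℓ : Level} (S : DecSetoid c ℓ) where
  open DecSetoid S
  open import Data.List.Membership.Setoid setoid using (_∈_)
  open import Data.List.Membership.Setoid.Properties using (∈-resp-≈; ∈-lookup; index-injective)
  open import Data.List.Membership.DecSetoid S using (_∈?_)
  open import Data.List.Relation.Binary.Subset.Setoid setoid using (_⊆_)
  open import Data.List.Relation.Unary.Unique.Setoid setoid using (Unique)

  Unique⇒lookup-injective : ∀ {xs} → Unique xs → ∀ {i j} → lookup xs i ≈ lookup xs j → i ≡.≡ j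
  Unique⇒lookup-injective (_ ∷ _)    {Fin.zero}  {Fin.zero}  _   = ≡.refl
  Unique⇒lookup-injective (x≉ ∷ _)   {Fin.zero}  {Fin.suc j} x≈  = contradiction x≈ (All.lookup x≉ (∈ₚ.∈-lookup j))
  Unique⇒lookup-injective (x≉ ∷ _)   {Fin.suc i} {Fin.zero}  ≈x  = contradiction (sym ≈x) (All.lookup x≉ (∈ₚ.∈-lookup i))
  Unique⇒lookup-injective (_ ∷ uniq) {Fin.suc i} {Fin.suc j} eq  = ≡.cong Fin.suc (Unique⇒lookup-injective uniq eq)

  Unique-⊆⇒length≤ : ∀ {xs ys} → Unique xs → xs ⊆ ys → length xs ≤ length ys
  Unique-⊆⇒length≤ {xs} {ys} uniq xs⊆ys = injective⇒≤ {f = position}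
    (λ eq → Unique⇒lookup-injective uniq (index-injective setoid _ _ eq))
    where
    position : Fin (length xs) → Fin (length ys)
    position i = index (xs⊆ys (∈-lookup setoid xs i))

  Unique-⊆-length≤⇒⊇ : ∀ {xs ys} → Unique xs → xs ⊆ ys → length ys ≤ length xs → ys ⊆ xs
  Unique-⊆-length≤⇒⊇ {xs} {ys} uniq xs⊆ys ys≤xs {y} y∈ys with y ∈? xs
  ... | yes y∈xs = y∈xs
  ... | no  y∉xs =
    contradiction (ℕ.≤-trans (Unique-⊆⇒length≤ (¬Any⇒All¬ xs y∉xs ∷ uniq) y∷xs⊆ys) ys≤xs) ℕ.1+n≰n
    where
    y∷xs⊆ys : y ∷ xs ⊆ ys
    y∷xs⊆ys (here x≈y)   = ∈-resp-≈ setoid (sym x≈y) y∈ys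
    y∷xs⊆ys (there x∈xs) = xs⊆ys x∈xs

module _ (F : FiniteField) where
  open FiniteField F
  open import Algebra.Definitions _≈_ using (AlmostLeftCancellative)
  open import Algebra.Properties.Ring ring
    using (-‿involutive; -‿injective; -0#≈0#; +-inverseˡ-unique; +-cancelʳ; //-rightDividesˡ)
    renaming (x∙y⁻¹≈ε⇒x≈y to x-y≈0⇒x≈y; x≈y⇒x∙y⁻¹≈ε to x≈y⇒x-y≈0)
  open IntegerCoefficientSolver commRing using (solve; _:=_; _:+_; _:*_; _:-_; :-_; con)
  open import Data.List.Membership.Setoid setoid using (_∈_)
  open import Data.List.Membership.Setoid.Properties using (∈-resp-≈)
  open import Relation.Binary.Reasoning.Setoid setoid

  decSetoid : DecSetoid 0ℓ 0ℓ
  decSetoid = record { isDecEquivalence = record { isEquivalence = isEquivalence ; _≟_ = _≟_ } }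

  x*y≈0⇒x≈0⊎y≈0 : ∀ {x y} → x * y ≈ 0# → x ≈ 0# ⊎ y ≈ 0#
  x*y≈0⇒x≈0⊎y≈0 {x} {y} xy≈0 with x ≟ 0#
  ... | yes x≈0 = inj₁ x≈0
  ... | no  x≉0 with inverse x x≉0
  ...   | w , xw≈1 = inj₂ (begin
    y              ≈⟨ *-identityˡ y ⟨
    1# * y         ≈⟨ *-congʳ xw≈1 ⟨
    (x * w) * y    ≈⟨ solve 3 (λ x w y → (x :* w) :* y := w :* (x :* y)) refl x w y ⟩
    w * (x * y)    ≈⟨ *-congˡ xy≈0 ⟩
    w * 0#         ≈⟨ zeroʳ w ⟩
    0#             ∎)

  *-cancelˡ : AlmostLeftCancellative 0# _*_
  *-cancelˡ x y z x≉0 xy≈xz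
    with x*y≈0⇒x≈0⊎y≈0 (trans (solve 3 (λ x y z → x :* (y :- z) := x :* y :- x :* z) refl x y z)
                              (x≈y⇒x-y≈0 xy≈xz))
  ... | inj₁ x≈0   = contradiction x≈0 x≉0
  ... | inj₂ y-z≈0 = x-y≈0⇒x≈y y z y-z≈0

  x*x≈0⇒x≈0 : ∀ {x} → x * x ≈ 0# → x ≈ 0#
  x*x≈0⇒x≈0 = reduce ∘ x*y≈0⇒x≈0⊎y≈0

  x*x≈y*y⇒x≈y⊎x≈-y : ∀ {x y} → x * x ≈ y * y → x ≈ y ⊎ x ≈ - y
  x*x≈y*y⇒x≈y⊎x≈-y {x} {y} xx≈yy
    with x*y≈0⇒x≈0⊎y≈0 (trans (solve 2 (λ x y → (x :- y) :* (x :+ y) := x :* x :- y :* y) refl x y)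
                              (x≈y⇒x-y≈0 xx≈yy))
  ... | inj₁ x-y≈0 = inj₁ (x-y≈0⇒x≈y x y x-y≈0)
  ... | inj₂ x+y≈0 = inj₂ (+-inverseˡ-unique x y x+y≈0)

  nonSquare⇒≉0 : ∀ {l} → NonSquare F l → ¬ l ≈ 0#
  nonSquare⇒≉0 ns l≈0 = ns (0# , trans (zeroˡ 0#) (sym l≈0))

  l*x²≈y²⇒x≈0×y≈0 : ∀ {l x y} → NonSquare F l → l * (x * x) ≈ y * y → x ≈ 0# × y ≈ 0#
  l*x²≈y²⇒x≈0×y≈0 {l} {x} {y} ns lxx≈yy with x ≟ 0#
  ... | yes x≈0 = x≈0 , x*x≈0⇒x≈0 (begin
    y * y           ≈⟨ lxx≈yy ⟨
    l * (x * x)     ≈⟨ *-congˡ (*-cong x≈0 x≈0) ⟩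
    l * (0# * 0#)   ≈⟨ *-congˡ (zeroˡ 0#) ⟩
    l * 0#          ≈⟨ zeroʳ l ⟩
    0#              ∎)
  ... | no x≉0 with inverse x x≉0
  ...   | w , xw≈1 = contradiction (y * w , sym (begin
    l                         ≈⟨ *-identityʳ l ⟨
    l * 1#                    ≈⟨ *-congˡ (*-identityˡ 1#) ⟨
    l * (1# * 1#)             ≈⟨ *-congˡ (*-cong xw≈1 xw≈1) ⟨
    l * ((x * w) * (x * w))   ≈⟨ solve 3 (λ l x w → l :* ((x :* w) :* (x :* w)) := (l :* (x :* x)) :* (w :* w)) refl l x w ⟩
    (l * (x * x)) * (w * w)   ≈⟨ *-congʳ lxx≈yy ⟩
    (y * y) * (w * w)         ≈⟨ solve 2 (λ y w → (y :* y) :* (w :* w) := (y :* w) :* (y :* w)) refl y w ⟩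
    (y * w) * (y * w)         ∎)) ns

  half-nonSquare : ∀ {h} → NonSquare F (two F) → h * two F ≈ 1# → NonSquare F h
  half-nonSquare {h} ns2 h2≈1 (z , zz≈h) = ns2 (two F * z , (begin
    (two F * z) * (two F * z)   ≈⟨ solve 2 (λ z t → (t :* z) :* (t :* z) := t :* ((z :* z) :* t)) refl z (two F) ⟩
    two F * ((z * z) * two F)   ≈⟨ *-congˡ (*-congʳ zz≈h) ⟩
    two F * (h * two F)         ≈⟨ *-congˡ h2≈1 ⟩
    two F * 1#                  ≈⟨ *-identityʳ (two F) ⟩
    two F                       ∎))

  Root : Carrier → Carrier → Carrier → Set
  Root l c y = y * y ≈ c ⊎ l * (y * y) ≈ c

  edge⇔root : ∀ {l f x y} → Edge F l f x y ⇔ Root l (f x) y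
  edge⇔root = mk⇔
    (λ e → ⊎-map (x-y≈0⇒x≈y _ _) (x-y≈0⇒x≈y _ _) (x*y≈0⇒x≈0⊎y≈0 e))
    [ (λ yy≈fx → trans (*-congʳ (x≈y⇒x-y≈0 yy≈fx)) (zeroˡ _))
    , (λ lyy≈fx → trans (*-congˡ (x≈y⇒x-y≈0 lyy≈fx)) (zeroʳ _)) ]

  root-cong : ∀ {l c d x y} → c ≈ d → x ≈ y → Root l c x → Root l d y
  root-cong c≈d x≈y = ⊎-map (λ xx≈c → trans (sym xx≈yy) (trans xx≈c c≈d))
                            (λ lxx≈c → trans (*-congˡ (sym xx≈yy)) (trans lxx≈c c≈d))
    where xx≈yy = *-cong x≈y x≈y

  root-neg : ∀ {l c y} → Root l c y → Root l c (- y)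
  root-neg {y = y} = ⊎-map (trans -y*-y≈y*y) (trans (*-congˡ -y*-y≈y*y))
    where -y*-y≈y*y = solve 1 (λ y → (:- y) :* (:- y) := y :* y) refl y

  root-at-0⇒≈0 : ∀ {l c} → Root l c 0# → c ≈ 0#
  root-at-0⇒≈0 {l} = [ (λ 00≈c → trans (sym 00≈c) (zeroˡ 0#))
                     , (λ l00≈c → trans (sym l00≈c) (trans (*-congˡ (zeroˡ 0#)) (zeroʳ l))) ]

  root-of-0⇒≈0 : ∀ {l y} → NonSquare F l → Root l 0# y → y ≈ 0#
  root-of-0⇒≈0 ns = [ x*x≈0⇒x≈0 , (λ lyy≈0 → proj₁ (l*x²≈y²⇒x≈0×y≈0 ns (trans lyy≈0 (sym (zeroˡ 0#))))) ]

  root-unique : ∀ {l c s y} → NonSquare F l → ¬ s ≈ 0# → Root l c s → Root l c y → y ≈ s ⊎ y ≈ - s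
  root-unique ns s≉0 (inj₁ ss≈c)  (inj₁ yy≈c)  = x*x≈y*y⇒x≈y⊎x≈-y (trans yy≈c (sym ss≈c))
  root-unique ns s≉0 (inj₂ lss≈c) (inj₂ lyy≈c) =
    x*x≈y*y⇒x≈y⊎x≈-y (*-cancelˡ _ _ _ (nonSquare⇒≉0 ns) (trans lyy≈c (sym lss≈c)))
  root-unique ns s≉0 (inj₁ ss≈c)  (inj₂ lyy≈c) =
    contradiction (proj₂ (l*x²≈y²⇒x≈0×y≈0 ns (trans lyy≈c (sym ss≈c)))) s≉0
  root-unique ns s≉0 (inj₂ lss≈c) (inj₁ yy≈c)  =
    contradiction (proj₁ (l*x²≈y²⇒x≈0×y≈0 ns (trans lss≈c (sym yy≈c)))) s≉0

  connected-invariant : ∀ {l f} (P : Carrier → Set) → (∀ {x y} → Adj F l f x y → P x ⇔ P y) →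
                        ∀ {x y} → Connected F l f x y → P x ⇔ P y
  connected-invariant P = EqClosure.gfold ⇔-isEquivalence P

  ⊎⇔∈ : ∀ {y p q r} → (y ≈ p ⊎ y ≈ q ⊎ y ≈ r) ⇔ y ∈ p ∷ q ∷ r ∷ []
  ⊎⇔∈ = mk⇔ [ here , [ there ∘ here , there ∘ there ∘ here ] ] from∈
    where
    from∈ : ∀ {y p q r} → y ∈ p ∷ q ∷ r ∷ [] → y ≈ p ⊎ y ≈ q ⊎ y ≈ r
    from∈ (here y≈p)                 = inj₁ y≈p
    from∈ (there (here y≈q))         = inj₂ (inj₁ y≈q)
    from∈ (there (there (here y≈r))) = inj₂ (inj₂ y≈r)
    from∈ (there (there (there ())))

  IsComponent : Carrier → (Carrier → Carrier) → Carrier → List Carrier → Set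
  IsComponent l f v S = ∀ y → Connected F l f v y ⇔ y ∈ S

  componentIs⇔isComponent : ∀ {l f v p q r} → ComponentIs F l f v p q r ⇔ IsComponent l f v (p ∷ q ∷ r ∷ [])
  componentIs⇔isComponent = mk⇔
    (λ comp y → mk⇔ (to ⊎⇔∈ ∘ proj₁ (comp y)) (proj₂ (comp y) ∘ from ⊎⇔∈))
    (λ comp y → from ⊎⇔∈ ∘ to (comp y) , from (comp y) ∘ to ⊎⇔∈)

  isComponent⇒adj-closed : ∀ {l f v S x y} → IsComponent l f v S → Adj F l f x y → x ∈ S ⇔ y ∈ S
  isComponent⇒adj-closed comp adj = mk⇔
    (λ x∈S → to (comp _) (EqClosure.transitive _ (from (comp _) x∈S) (EqClosure.return adj)))
    (λ y∈S → to (comp _) (EqClosure.transitive _ (from (comp _) y∈S) (EqClosure.symmetric _ (EqClosure.return adj))))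

  isComponent⇒connected : ∀ {l f v S x y} → IsComponent l f v S → x ∈ S → y ∈ S → Connected F l f x y
  isComponent⇒connected comp x∈S y∈S =
    EqClosure.transitive _ (EqClosure.symmetric _ (from (comp _) x∈S)) (from (comp _) y∈S)

  adj-closed⇒isComponent : ∀ {l f v S} → (∀ {x y} → Adj F l f x y → x ∈ S ⇔ y ∈ S) →
                           v ∈ S → (∀ {y} → y ∈ S → Connected F l f v y) → IsComponent l f v S
  adj-closed⇒isComponent {S = S} closed v∈S connected y =
    mk⇔ (λ v~y → to (connected-invariant (_∈ S) closed v~y) v∈S) connected

  x≈[x-y]+y : ∀ x y → x ≈ (x - y) + y
  x≈[x-y]+y x y = sym (//-rightDividesˡ y x)

  x+a≈a⇔x≈0 : ∀ {x a} → x + a ≈ a ⇔ x ≈ 0#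
  x+a≈a⇔x≈0 {x} {a} = mk⇔ (λ x+a≈a → +-cancelʳ a x 0# (trans x+a≈a (sym (+-identityˡ a))))
                          (λ x≈0 → trans (+-congʳ x≈0) (+-identityˡ a))

  x+a≈2a⇔x≈a : ∀ {x a} → x + a ≈ two F * a ⇔ x ≈ a
  x+a≈2a⇔x≈a {x} {a} = mk⇔ (λ x+a≈2a → +-cancelʳ a x a (trans x+a≈2a 2a≈a+a))
                           (λ x≈a → trans (+-congʳ x≈a) (sym 2a≈a+a))
    where 2a≈a+a = solve 1 (λ a → con (+ 2) :* a := a :+ a) refl a

  root⇒adj : ∀ {l a x y} → Root l (x + a) y → Adj F l (_+ a) x y
  root⇒adj {a = a} = inj₁ ∘ from (edge⇔root {f = _+ a})

  root⇒predecessor-adj : ∀ {l a t y} → Root l t y → Adj F l (_+ a) (t - a) y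
  root⇒predecessor-adj {a = a} {t} r = root⇒adj (root-cong (x≈[x-y]+y t a) refl r)

  adj-preserves-0 : ∀ {l a x y} → NonSquare F l → a ≈ 0# → Adj F l (_+ a) x y → x ≈ 0# ⇔ y ≈ 0#
  adj-preserves-0 {l} {a} {x} ns a≈0 (inj₁ e) = mk⇔
    (λ x≈0 → root-of-0⇒≈0 ns (root-cong (trans (+-cong x≈0 a≈0) (+-identityˡ 0#)) refl r))
    (λ y≈0 → begin
      x        ≈⟨ +-identityʳ x ⟨
      x + 0#   ≈⟨ +-congˡ a≈0 ⟨
      x + a    ≈⟨ root-at-0⇒≈0 (root-cong refl y≈0 r) ⟩
      0#       ∎)
    where r = to (edge⇔root {f = _+ a}) e
  adj-preserves-0 ns a≈0 (inj₂ x≈y) = mk⇔ (trans (sym x≈y)) (trans x≈y)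

  0∷±_ : Carrier → List Carrier
  0∷± a = 0# ∷ a ∷ - a ∷ []

  difference∈0∷±⇒≈a⊎≈2a : ∀ {t a} → ¬ t ≈ 0# → t - a ∈ 0∷± a → t ≈ a ⊎ t ≈ two F * a
  difference∈0∷±⇒≈a⊎≈2a {t} {a} t≉0 (here t-a≈0) = inj₁ (trans (x≈[x-y]+y t a) (from x+a≈a⇔x≈0 t-a≈0))
  difference∈0∷±⇒≈a⊎≈2a {t} {a} t≉0 (there (here t-a≈a)) = inj₂ (trans (x≈[x-y]+y t a) (from x+a≈2a⇔x≈a t-a≈a))
  difference∈0∷±⇒≈a⊎≈2a {t} {a} t≉0 (there (there (here t-a≈-a))) =
    contradiction (trans (x≈[x-y]+y t a) (trans (+-congʳ t-a≈-a) (-‿inverseˡ a))) t≉0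

  -- {a², λa²} = {a, 2a}: the two in-neighbours a² − a and λa² − a of a are 0 and a.
  PredecessorCondition : Carrier → Carrier → Set
  PredecessorCondition l a = (a * a ≈ a × l * (a * a) ≈ two F * a) ⊎ (a * a ≈ two F * a × l * (a * a) ≈ a)

  condition⇒root⇔ : ∀ {l a t} → PredecessorCondition l a → Root l t a ⇔ (t ≈ a ⊎ t ≈ two F * a)
  condition⇒root⇔ (inj₁ (aa≈a , laa≈2a)) = mk⇔
    [ (λ aa≈t → inj₁ (trans (sym aa≈t) aa≈a)) , (λ laa≈t → inj₂ (trans (sym laa≈t) laa≈2a)) ]
    [ (λ t≈a → inj₁ (trans aa≈a (sym t≈a))) , (λ t≈2a → inj₂ (trans laa≈2a (sym t≈2a))) ]
  condition⇒root⇔ (inj₂ (aa≈2a , laa≈a)) = mk⇔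
    [ (λ aa≈t → inj₂ (trans (sym aa≈t) aa≈2a)) , (λ laa≈t → inj₁ (trans (sym laa≈t) laa≈a)) ]
    [ (λ t≈a → inj₂ (trans laa≈a (sym t≈a))) , (λ t≈2a → inj₁ (trans aa≈2a (sym t≈2a))) ]

  module _ {l a : Carrier} (ns : NonSquare F l) (a≉0 : ¬ a ≈ 0#) (cond : PredecessorCondition l a) where

    ±a∈0∷± : ∀ {y} → y ≈ a ⊎ y ≈ - a → y ∈ 0∷± a
    ±a∈0∷± = [ there ∘ here , there ∘ there ∘ here ]

    successor-closed : ∀ {x y} → x ∈ 0∷± a → Root l (x + a) y → y ∈ 0∷± a
    successor-closed (here x≈0) r =
      ±a∈0∷± (root-unique ns a≉0 (from (condition⇒root⇔ cond) (inj₁ (from x+a≈a⇔x≈0 x≈0))) r)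
    successor-closed (there (here x≈a)) r =
      ±a∈0∷± (root-unique ns a≉0 (from (condition⇒root⇔ cond) (inj₂ (from x+a≈2a⇔x≈a x≈a))) r)
    successor-closed (there (there (here x≈-a))) r =
      here (root-of-0⇒≈0 ns (root-cong (trans (+-congʳ x≈-a) (-‿inverseˡ a)) refl r))

    predecessor-of-a∈0∷± : ∀ {x} → Root l (x + a) a → x ∈ 0∷± a
    predecessor-of-a∈0∷± r =
      [ here ∘ to x+a≈a⇔x≈0 , there ∘ here ∘ to x+a≈2a⇔x≈a ] (to (condition⇒root⇔ cond) r)

    predecessor-closed : ∀ {x y} → y ∈ 0∷± a → Root l (x + a) y → x ∈ 0∷± a
    predecessor-closed {x} (here y≈0) r =
      there (there (here (+-inverseˡ-unique x a (root-at-0⇒≈0 (root-cong refl y≈0 r)))))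
    predecessor-closed (there (here y≈a)) r = predecessor-of-a∈0∷± (root-cong refl y≈a r)
    predecessor-closed (there (there (here y≈-a))) r =
      predecessor-of-a∈0∷± (root-cong refl (trans (-‿cong y≈-a) (-‿involutive a)) (root-neg r))

    adj-closed : ∀ {x y} → Adj F l (_+ a) x y → x ∈ 0∷± a ⇔ y ∈ 0∷± a
    adj-closed (inj₁ e)   = mk⇔ (λ x∈ → successor-closed x∈ r) (λ y∈ → predecessor-closed y∈ r)
      where r = to (edge⇔root {f = _+ a}) e
    adj-closed (inj₂ x≈y) = mk⇔ (∈-resp-≈ setoid x≈y) (∈-resp-≈ setoid (sym x≈y))

    0→a : Root l (0# + a) a
    0→a = from (condition⇒root⇔ cond) (inj₁ (+-identityˡ a))

    connected-from-0 : ∀ {y} → y ∈ 0∷± a → Connected F l (_+ a) 0# y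
    connected-from-0 (here y≈0)                  = EqClosure.return (inj₂ (sym y≈0))
    connected-from-0 (there (here y≈a))          = EqClosure.return (root⇒adj (root-cong refl (sym y≈a) 0→a))
    connected-from-0 (there (there (here y≈-a))) = EqClosure.return (root⇒adj (root-cong refl (sym y≈-a) (root-neg 0→a)))

    component-of-0 : ComponentIs F l (_+ a) 0# 0# a (- a)
    component-of-0 = from componentIs⇔isComponent (adj-closed⇒isComponent adj-closed (here refl) connected-from-0)

  ExceptionalPair : Carrier → Carrier → Set
  ExceptionalPair l a = (l ≈ two F × a ≈ 1#) ⊎ (l * two F ≈ 1# × a ≈ two F)

  exceptional⇒condition : ∀ {l a} → ExceptionalPair l a → PredecessorCondition l a
  exceptional⇒condition {l} {a} (inj₁ (l≈2 , a≈1)) = inj₁ (aa≈a , trans (*-congˡ aa≈a) (*-congʳ l≈2))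
    where aa≈a = trans (*-congʳ a≈1) (*-identityˡ a)
  exceptional⇒condition {l} {a} (inj₂ (l2≈1 , a≈2)) = inj₂ (*-congʳ a≈2 , (begin
    l * (a * a)        ≈⟨ *-congˡ (*-congʳ a≈2) ⟩
    l * (two F * a)    ≈⟨ *-assoc l (two F) a ⟨
    (l * two F) * a    ≈⟨ *-congʳ l2≈1 ⟩
    1# * a             ≈⟨ *-identityˡ a ⟩
    a                  ∎))

  module _ (odd : OddChar F) where

    x≈-x⇒x≈0 : ∀ {x} → x ≈ - x → x ≈ 0#
    x≈-x⇒x≈0 {x} x≈-x with x*y≈0⇒x≈0⊎y≈0 (begin
        two F * x  ≈⟨ solve 1 (λ x → con (+ 2) :* x := x :+ x) refl x ⟩
        x + x      ≈⟨ +-congʳ x≈-x ⟩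
        - x + x    ≈⟨ -‿inverseˡ x ⟩
        0#         ∎)
    ... | inj₁ 2≈0 = contradiction 2≈0 odd
    ... | inj₂ x≈0 = x≈0

    0≉a×0≉-a×a≉-a : ∀ {a} → ¬ a ≈ 0# → ¬ 0# ≈ a × ¬ 0# ≈ - a × ¬ a ≈ - a
    0≉a×0≉-a×a≉-a a≉0 =
        (λ 0≈a → a≉0 (sym 0≈a))
      , (λ 0≈-a → a≉0 (-‿injective (trans (sym 0≈-a) (sym -0#≈0#))))
      , (a≉0 ∘ x≈-x⇒x≈0)

    negation-swap⇒fixed : ∀ {p q w} → - p ≈ q → ¬ w ≈ p → ¬ w ≈ q → - w ≈ p ⊎ - w ≈ q ⊎ - w ≈ w → w ≈ 0#
    negation-swap⇒fixed {w = w} -p≈q w≉p w≉q (inj₁ -w≈p) =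
      contradiction (trans (sym (-‿involutive w)) (trans (-‿cong -w≈p) -p≈q)) w≉q
    negation-swap⇒fixed -p≈q w≉p w≉q (inj₂ (inj₁ -w≈q)) = contradiction (-‿injective (trans -w≈q (sym -p≈q))) w≉p
    negation-swap⇒fixed -p≈q w≉p w≉q (inj₂ (inj₂ -w≈w)) = x≈-x⇒x≈0 (sym -w≈w)

    0∈negation-closed : ∀ {p q r} → ¬ p ≈ q → ¬ p ≈ r → ¬ q ≈ r →
                        (∀ {y} → y ∈ p ∷ q ∷ r ∷ [] → - y ∈ p ∷ q ∷ r ∷ []) → 0# ∈ p ∷ q ∷ r ∷ []
    0∈negation-closed {p} p≉q p≉r q≉r neg with p ≟ 0#
    ... | yes p≈0 = here (sym p≈0)
    ... | no p≉0 with from ⊎⇔∈ (neg (here refl))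
    ...   | inj₁ -p≈p        = contradiction (x≈-x⇒x≈0 (sym -p≈p)) p≉0
    ...   | inj₂ (inj₁ -p≈q) = there (there (here (sym (negation-swap⇒fixed -p≈q (p≉r ∘ sym) (q≉r ∘ sym)
                                  (from ⊎⇔∈ (neg (there (there (here refl)))))))))
    ...   | inj₂ (inj₂ -p≈r) = there (here (sym (negation-swap⇒fixed -p≈r (p≉q ∘ sym) q≉r
                                  (map₂ swap (from ⊎⇔∈ (neg (there (here refl))))))))

    module ComponentOfSize3 {l a v p q r : Carrier} (ns : NonSquare F l)
                            (p≉q : ¬ p ≈ q) (p≉r : ¬ p ≈ r) (q≉r : ¬ q ≈ r)
                            (comp : ComponentIs F l (_+ a) v p q r) where
      open UniquePigeonhole decSetoid using (Unique-⊆-length≤⇒⊇)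

      C : List Carrier
      C = p ∷ q ∷ r ∷ []

      closed : ∀ {x y} → Adj F l (_+ a) x y → x ∈ C ⇔ y ∈ C
      closed = isComponent⇒adj-closed (to componentIs⇔isComponent comp)

      root⇒predecessor∈C : ∀ {t y} → Root l t y → y ∈ C → t - a ∈ C
      root⇒predecessor∈C r = from (closed (root⇒predecessor-adj r))

      negation-closed : ∀ {y} → y ∈ C → - y ∈ C
      negation-closed y∈C =
        to (closed (root⇒predecessor-adj (root-neg (inj₁ refl)))) (root⇒predecessor∈C (inj₁ refl) y∈C)

      0∈C : 0# ∈ C
      0∈C = 0∈negation-closed p≉q p≉r q≉r negation-closed

      -a∈C : - a ∈ C
      -a∈C = ∈-resp-≈ setoid (+-identityˡ (- a)) (root⇒predecessor∈C (inj₁ (zeroˡ 0#)) 0∈C)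

      a≉0 : ¬ a ≈ 0#
      a≉0 a≈0 = p≉q (trans (vanishes (here refl)) (sym (vanishes (there (here refl)))))
        where
        vanishes : ∀ {y} → y ∈ C → y ≈ 0#
        vanishes y∈C = to (connected-invariant (_≈ 0#) (adj-preserves-0 ns a≈0)
                             (isComponent⇒connected (to componentIs⇔isComponent comp) 0∈C y∈C)) refl

      a∈C : a ∈ C
      a∈C = ∈-resp-≈ setoid (-‿involutive a) (negation-closed -a∈C)

      C⊆0∷±a : ∀ {y} → y ∈ C → y ∈ 0∷± a
      C⊆0∷±a with 0≉a×0≉-a×a≉-a a≉0
      ... | 0≉a , 0≉-a , a≉-a =
        Unique-⊆-length≤⇒⊇ ((0≉a ∷ 0≉-a ∷ []) ∷ (a≉-a ∷ []) ∷ [] ∷ []) 0∷±a⊆C ℕ.≤-refl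
        where
        0∷±a⊆C : ∀ {y} → y ∈ 0∷± a → y ∈ C
        0∷±a⊆C (here y≈0)                  = ∈-resp-≈ setoid (sym y≈0) 0∈C
        0∷±a⊆C (there (here y≈a))          = ∈-resp-≈ setoid (sym y≈a) a∈C
        0∷±a⊆C (there (there (here y≈-a))) = ∈-resp-≈ setoid (sym y≈-a) -a∈C

      root-at-a⇒≈a⊎≈2a : ∀ {t} → Root l t a → t ≈ a ⊎ t ≈ two F * a
      root-at-a⇒≈a⊎≈2a r = difference∈0∷±⇒≈a⊎≈2a (λ t≈0 → a≉0 (root-of-0⇒≈0 ns (root-cong t≈0 refl r)))
                                                  (C⊆0∷±a (root⇒predecessor∈C r a∈C))

      condition : PredecessorCondition l a
      condition with root-at-a⇒≈a⊎≈2a (inj₁ refl) | root-at-a⇒≈a⊎≈2a (inj₂ refl)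
      ... | inj₁ aa≈a  | inj₂ laa≈2a = inj₁ (aa≈a , laa≈2a)
      ... | inj₂ aa≈2a | inj₁ laa≈a  = inj₂ (aa≈2a , laa≈a)
      ... | inj₁ aa≈a  | inj₁ laa≈a  = contradiction (proj₁ (l*x²≈y²⇒x≈0×y≈0 ns (trans laa≈a (sym aa≈a)))) a≉0
      ... | inj₂ aa≈2a | inj₂ laa≈2a = contradiction (proj₁ (l*x²≈y²⇒x≈0×y≈0 ns (trans laa≈2a (sym aa≈2a)))) a≉0

    condition⇒exceptional : ∀ {l a} → ¬ a ≈ 0# → PredecessorCondition l a → ExceptionalPair l a
    condition⇒exceptional {l} {a} a≉0 (inj₁ (aa≈a , laa≈2a)) = inj₁ (l≈2 , a≈1)
      where
      a≈1 = *-cancelˡ a a 1# a≉0 (trans aa≈a (sym (*-identityʳ a)))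
      l≈2 = *-cancelˡ a l (two F) a≉0 (begin
        a * l          ≈⟨ *-comm a l ⟩
        l * a          ≈⟨ *-congˡ aa≈a ⟨
        l * (a * a)    ≈⟨ laa≈2a ⟩
        two F * a      ≈⟨ *-comm (two F) a ⟩
        a * two F      ∎)
    condition⇒exceptional {l} {a} a≉0 (inj₂ (aa≈2a , laa≈a)) = inj₂ (l2≈1 , a≈2)
      where
      a≈2 = *-cancelˡ a a (two F) a≉0 (trans aa≈2a (*-comm (two F) a))
      l2≈1 = *-cancelˡ (two F) (l * two F) 1# odd (begin
        two F * (l * two F)   ≈⟨ solve 2 (λ l t → t :* (l :* t) := l :* (t :* t)) refl l (two F) ⟩
        l * (two F * two F)   ≈⟨ *-congˡ (*-cong a≈2 a≈2) ⟨
        l * (a * a)           ≈⟨ laa≈a ⟩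
        a                     ≈⟨ a≈2 ⟩
        two F                 ≈⟨ *-identityʳ (two F) ⟨
        two F * 1#            ∎)

    hasComponentOfSize3⇒exceptional : ∀ {l a} → NonSquare F l → HasComponentOfSize3 F l (_+ a) → ExceptionalPair l a
    hasComponentOfSize3⇒exceptional ns (_ , p , q , r , p≉q , p≉r , q≉r , comp) = condition⇒exceptional a≉0 condition
      where open ComponentOfSize3 ns p≉q p≉r q≉r comp

    exceptional⇒a≉0 : ∀ {l a} → ExceptionalPair l a → ¬ a ≈ 0#
    exceptional⇒a≉0 (inj₁ (_ , a≈1)) a≈0 = 1≉0 (trans (sym a≈1) a≈0)
    exceptional⇒a≉0 (inj₂ (_ , a≈2)) a≈0 = odd (trans (sym a≈2) a≈0)

    exceptional⇒hasComponentOfSize3 : ∀ {l a} → NonSquare F l → ExceptionalPair l a → HasComponentOfSize3 F l (_+ a)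
    exceptional⇒hasComponentOfSize3 ns exc =
      let a≉0                 = exceptional⇒a≉0 exc
          (0≉a , 0≉-a , a≉-a) = 0≉a×0≉-a×a≉-a a≉0
      in 0# , 0# , _ , _ , 0≉a , 0≉-a , a≉-a , component-of-0 ns a≉0 (exceptional⇒condition exc)

proposition4p6 : (F : FiniteField) → OddChar F →
    let open FiniteField F in
    ((λ' a : Carrier) → NonSquare F λ' →
       HasComponentOfSize3 F λ' (λ x → x + a)
         ⇔ ((λ' ≈ two F × a ≈ 1#) ⊎ (λ' * two F ≈ 1# × a ≈ two F)))
    × (NonSquare F (two F) →
         ComponentIs F (two F) (λ x → x + 1#) 0# 0# 1# (- 1#)
         × ((h : Carrier) → h * two F ≈ 1# →
              ComponentIs F h (λ x → x + two F) 0# 0# (two F) (- two F)))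
proposition4p6 F odd =
    (λ _ _ ns → mk⇔ (hasComponentOfSize3⇒exceptional F odd ns) (exceptional⇒hasComponentOfSize3 F odd ns))
  , λ ns2 → component-of-0 F ns2 1≉0 (exceptional⇒condition F (inj₁ (refl , refl)))
          , λ h h2≈1 → component-of-0 F (half-nonSquare F ns2 h2≈1) odd (exceptional⇒condition F (inj₂ (h2≈1 , refl)))
  where open FiniteField F
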